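{- Let $q = 2^n$ for a positive integer $n$ such that $q-1$ is prime, and let $s$ be an integer with $2 \leq s \leq q-1$. Then there exists a linear $(2,s,q)$-AONT over $\mathbb{F}_q$, i.e., an invertible $s \times s$ matrix over $\mathbb{F}_q$ all of whose $2 \times 2$ submatrices are invertible.
   Context: For a prime power $q$ and integers $1 \le t \le s$, a linear $(t,s,q)$-all-or-nothing transform (AONT) is an invertible $s\times s$ matrix $M$ over the finite field $\mathbb{F}_q$ defining the bijection $\mathbf{y}\mapsto \mathbf{x}=\mathbf{y}M$ of $\mathbb{F}_q^s$ such that, for every set $I$ of $t$ input coordinates and every set $J$ of $t$ output coordinates, knowing the $s-t$ output values $y_j$, $j\notin J$, gives no information about the values $x_i$, $i \in I$. It is a known fact that an invertible $M$ is a linear $(t,s,q)$-AONT if and only if every $t\times t$ submatrix of $M$ is invertible. -}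

module Defs where

open import Level using (Level; _⊔_)
open import Data.Nat using (ℕ; zero; suc)
open import Data.Fin using (Fin; zero; suc; _<_)
import Data.Fin
import Relation.Nullary
open import Data.Product using (Σ; ∃; _×_; _,_)
open import Relation.Binary.PropositionalEquality using (_≡_)
open import Relation.Nullary using (¬_)
open import Algebra.Bundles using (CommutativeRing)

record IsField {c ℓ : Level} (R : CommutativeRing c ℓ) : Set (c ⊔ ℓ) where
  open CommutativeRing R
  field
    1≉0     : ¬ (1# ≈ 0#)
    inverse : ∀ x → ¬ (x ≈ 0#) → Σ Carrier λ y → (x * y) ≈ 1#

record HasOrder {c ℓ : Level} (R : CommutativeRing c ℓ) (q : ℕ) : Set (c ⊔ ℓ) where
  open CommutativeRing R
  field
    enum       : Fin q → Carrier
    injective  : ∀ i j → enum i ≈ enum j → i ≡ j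
    surjective : ∀ x → Σ (Fin q) λ i → enum i ≈ x

module MatrixOps {c ℓ : Level} (R : CommutativeRing c ℓ) where
  open CommutativeRing R using (Carrier; _≈_; _+_; _*_; 0#; 1#)

  Matrix : ℕ → ℕ → Set c
  Matrix k m = Fin k → Fin m → Carrier

  sumFin : (n : ℕ) → (Fin n → Carrier) → Carrier
  sumFin zero    f = 0#
  sumFin (suc n) f = f zero + sumFin n (λ i → f (suc i))

  _⊗_ : ∀ {k m p} → Matrix k m → Matrix m p → Matrix k p
  _⊗_ {m = m} A B i j = sumFin m (λ l → A i l * B l j)

  identity : (k : ℕ) → Matrix k k
  identity k i j with i Data.Fin.≟ j
  ... | Relation.Nullary.yes _ = 1#
  ... | Relation.Nullary.no  _ = 0#

  _≋_ : ∀ {k m} → Matrix k m → Matrix k m → Set ℓ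
  A ≋ B = ∀ i j → A i j ≈ B i j

  Invertible : (k : ℕ) → Matrix k k → Set (c ⊔ ℓ)
  Invertible k M = Σ (Matrix k k) λ N → ((M ⊗ N) ≋ identity k) × ((N ⊗ M) ≋ identity k)

  sub2 : ∀ {s} → Matrix s s → Fin s → Fin s → Fin s → Fin s → Matrix 2 2
  sub2 M i₁ i₂ j₁ j₂ zero       zero       = M i₁ j₁
  sub2 M i₁ i₂ j₁ j₂ zero       (suc _)    = M i₁ j₂
  sub2 M i₁ i₂ j₁ j₂ (suc _)    zero       = M i₂ j₁
  sub2 M i₁ i₂ j₁ j₂ (suc _)    (suc _)    = M i₂ j₂

  IsLinear2AONT : (s : ℕ) → Matrix s s → Set (c ⊔ ℓ)
  IsLinear2AONT s M =
    Invertible s M ×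
    (∀ (i₁ i₂ j₁ j₂ : Fin s) → i₁ < i₂ → j₁ < j₂ → Invertible 2 (sub2 M i₁ i₂ j₁ j₂))

module Submission where

-- Take the Vandermonde matrix (aᵢ ^ j) on s distinct nonzero elements aᵢ of F, possible since
-- s ≤ q - 1.  It is invertible: the Lagrange polynomials give a right inverse, and a polynomial
-- with s coefficients vanishing at the s points aᵢ is zero, which makes that right inverse
-- two-sided.  Its 2 × 2 minors are (aᵢ aⱼ) ^ t · (aⱼ ^ d - aᵢ ^ d) with 0 < d < s.  By
-- Fermat c ^ (q - 1) = 1 for c ≠ 0, and q - 1 is prime, so c ^ d = 1 forces c = 1 (Bézout);
-- thus x ↦ x ^ d is injective on nonzero elements and no minor vanishes.

open import Level using (Level)
open import Algebra.Bundles using (CommutativeRing; Semiring)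
open import Data.Nat as ℕ using (ℕ; zero; suc; _∸_; _≤_)
import Data.Nat.Properties as ℕ
open import Data.Nat.Coprimality using (Coprime; coprime-Bézout; prime⇒coprime)
open import Data.Nat.GCD using (module Bézout)
open import Data.Nat.Primality using (Prime)
open import Data.Fin as Fin using (Fin; zero; suc; toℕ; punchIn; punchOut)
import Data.Fin.Properties as Fin
open import Data.Product using (Σ; _,_; proj₁; proj₂)
open import Function using (_∘_)
open import Function.Definitions using (Injective)
open import Relation.Binary.PropositionalEquality as ≡ using (_≡_; _≢_)
open import Defs

module Powers {c ℓ} (R : Semiring c ℓ) where
  open Semiring R
  open import Algebra.Properties.Semiring.Exp R
  open import Relation.Binary.Reasoning.Setoid setoid

  1^n≈1 : ∀ n → 1# ^ n ≈ 1#
  1^n≈1 zero    = refl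
  1^n≈1 (suc n) = trans (*-identityˡ _) (1^n≈1 n)

  ^[k*m]≈1 : ∀ k {m x} → x ^ m ≈ 1# → x ^ (k ℕ.* m) ≈ 1#
  ^[k*m]≈1 k {m} {x} xᵐ≈1 = begin
    x ^ (k ℕ.* m) ≡⟨ ≡.cong (x ^_) (ℕ.*-comm k m) ⟩
    x ^ (m ℕ.* k) ≈⟨ ^-assocʳ x m k ⟨
    (x ^ m) ^ k   ≈⟨ ^-congˡ k xᵐ≈1 ⟩
    1# ^ k        ≈⟨ 1^n≈1 k ⟩
    1#            ∎

  ^[1+k*n]≡^[j*m]⇒≈1 : ∀ {k j m n x} → 1 ℕ.+ k ℕ.* n ≡ j ℕ.* m →
                       x ^ m ≈ 1# → x ^ n ≈ 1# → x ≈ 1#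
  ^[1+k*n]≡^[j*m]⇒≈1 {k} {j} {m} {n} {x} eq xᵐ≈1 xⁿ≈1 = begin
    x                   ≈⟨ *-identityʳ x ⟨
    x * 1#              ≈⟨ *-congˡ (^[k*m]≈1 k xⁿ≈1) ⟨
    x ^ (1 ℕ.+ k ℕ.* n) ≡⟨ ≡.cong (x ^_) eq ⟩
    x ^ (j ℕ.* m)       ≈⟨ ^[k*m]≈1 j xᵐ≈1 ⟩
    1#                  ∎

  ^≈1-coprime : ∀ {m n x} → Coprime m n → x ^ m ≈ 1# → x ^ n ≈ 1# → x ≈ 1#
  ^≈1-coprime {m} {n} m⊥n xᵐ≈1 xⁿ≈1 with coprime-Bézout m⊥n
  ... | Bézout.Identity.+- a b eq = ^[1+k*n]≡^[j*m]⇒≈1 {b} {a} {m} {n} eq xᵐ≈1 xⁿ≈1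
  ... | Bézout.Identity.-+ a b eq = ^[1+k*n]≡^[j*m]⇒≈1 {a} {b} {n} {m} eq xⁿ≈1 xᵐ≈1

module FieldProperties {c ℓ} (F : CommutativeRing c ℓ) (isField : IsField F) where
  open CommutativeRing F hiding (zero)
  open IsField isField
  open import Algebra.Properties.Ring ring using (x∙y⁻¹≈ε⇒x≈y; [y-z]x≈yx-zx)
  open import Algebra.Properties.Semiring.Exp semiring using (_^_; ^-homo-*)
  open import Algebra.Properties.CommutativeMonoid.Sum *-commutativeMonoid
    using (sum-remove; ∑-distrib-+; sum-replicate) renaming (sum to product)
  open import Algebra.Solver.Ring.NaturalCoefficients.Default commutativeSemiring
    using (solve; _:=_; _:*_)
  open import Relation.Binary.Reasoning.Setoid setoid

  inv : ∀ {x} → x ≉ 0# → Carrier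
  inv {x} x≉0 = proj₁ (inverse x x≉0)

  *-inverseʳ : ∀ {x} (x≉0 : x ≉ 0#) → x * inv x≉0 ≈ 1#
  *-inverseʳ {x} x≉0 = proj₂ (inverse x x≉0)

  *-inverseˡ : ∀ {x} (x≉0 : x ≉ 0#) → inv x≉0 * x ≈ 1#
  *-inverseˡ x≉0 = trans (*-comm _ _) (*-inverseʳ x≉0)

  *-cancelˡ : ∀ {x y z} → x ≉ 0# → x * y ≈ x * z → y ≈ z
  *-cancelˡ {x} {y} {z} x≉0 xy≈xz = begin
    y                 ≈⟨ *-identityˡ y ⟨
    1# * y            ≈⟨ *-congʳ (*-inverseˡ x≉0) ⟨
    inv x≉0 * x * y   ≈⟨ *-assoc _ x y ⟩
    inv x≉0 * (x * y) ≈⟨ *-congˡ xy≈xz ⟩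
    inv x≉0 * (x * z) ≈⟨ *-assoc _ x z ⟨
    inv x≉0 * x * z   ≈⟨ *-congʳ (*-inverseˡ x≉0) ⟩
    1# * z            ≈⟨ *-identityˡ z ⟩
    z                 ∎

  *-nonzero : ∀ {x y} → x ≉ 0# → y ≉ 0# → x * y ≉ 0#
  *-nonzero {x} {y} x≉0 y≉0 xy≈0 = y≉0 (*-cancelˡ x≉0 (trans xy≈0 (sym (zeroʳ x))))

  inv-nonzero : ∀ {x} (x≉0 : x ≉ 0#) → inv x≉0 ≉ 0#
  inv-nonzero {x} x≉0 x⁻¹≈0 = 1≉0 (begin
    1#          ≈⟨ *-inverseʳ x≉0 ⟨
    x * inv x≉0 ≈⟨ *-congˡ x⁻¹≈0 ⟩
    x * 0#      ≈⟨ zeroʳ x ⟩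
    0#          ∎)

  ^-nonzero : ∀ {x} n → x ≉ 0# → x ^ n ≉ 0#
  ^-nonzero zero    x≉0 = 1≉0
  ^-nonzero (suc n) x≉0 = *-nonzero x≉0 (^-nonzero n x≉0)

  product-nonzero : ∀ {n} (f : Fin n → Carrier) → (∀ k → f k ≉ 0#) → product f ≉ 0#
  product-nonzero {zero}  f f≉0 = 1≉0
  product-nonzero {suc n} f f≉0 = *-nonzero (f≉0 zero) (product-nonzero (f ∘ suc) (f≉0 ∘ suc))

  product-scale : ∀ {n} g (f : Fin n → Carrier) → product (λ k → g * f k) ≈ g ^ n * product f
  product-scale {n} g f = trans (∑-distrib-+ (λ _ → g) f) (*-congʳ (sum-replicate n))

  product-zero : ∀ {n} (f : Fin n → Carrier) k → f k ≈ 0# → product f ≈ 0#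
  product-zero {suc n} f k fₖ≈0 = trans (sum-remove f) (trans (*-congʳ fₖ≈0) (zeroˡ _))

  x^t*y^[t+d]≈x^[t+d]*y^t⇒y^d≈x^d : ∀ {x y} t d → x ≉ 0# → y ≉ 0# →
                                     x ^ t * y ^ (t ℕ.+ d) ≈ x ^ (t ℕ.+ d) * y ^ t → y ^ d ≈ x ^ d
  x^t*y^[t+d]≈x^[t+d]*y^t⇒y^d≈x^d {x} {y} t d x≉0 y≉0 eq =
    *-cancelˡ (*-nonzero (^-nonzero t x≉0) (^-nonzero t y≉0)) (begin
      x ^ t * y ^ t * y ^ d     ≈⟨ *-assoc _ _ _ ⟩
      x ^ t * (y ^ t * y ^ d)   ≈⟨ *-congˡ (^-homo-* y t d) ⟨
      x ^ t * y ^ (t ℕ.+ d)     ≈⟨ eq ⟩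
      x ^ (t ℕ.+ d) * y ^ t     ≈⟨ *-congʳ (^-homo-* x t d) ⟩
      x ^ t * x ^ d * y ^ t     ≈⟨ solve 3 (λ a b c → a :* b :* c := a :* c :* b) refl (x ^ t) (x ^ d) (y ^ t) ⟩
      x ^ t * y ^ t * x ^ d     ∎)

  x*z≈y*z⇒z≈0 : ∀ {x y z} → x ≉ y → x * z ≈ y * z → z ≈ 0#
  x*z≈y*z⇒z≈0 {x} {y} {z} x≉y xz≈yz = *-cancelˡ x-y≉0 (begin
    (x - y) * z   ≈⟨ [y-z]x≈yx-zx z x y ⟩
    x * z - y * z ≈⟨ +-congʳ xz≈yz ⟩
    y * z - y * z ≈⟨ -‿inverseʳ (y * z) ⟩
    0#            ≈⟨ zeroʳ (x - y) ⟨
    (x - y) * 0#  ∎)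
    where
    x-y≉0 : x - y ≉ 0#
    x-y≉0 x-y≈0 = x≉y (x∙y⁻¹≈ε⇒x≈y x y x-y≈0)

module FiniteField {c ℓ} (F : CommutativeRing c ℓ) (isField : IsField F)
                   {p} (hasOrder : HasOrder F (suc p)) where
  open CommutativeRing F hiding (zero)
  open IsField isField
  open HasOrder hasOrder
  open FieldProperties F isField
  open Powers semiring using (1^n≈1; ^≈1-coprime)
  open import Algebra.Properties.Semiring.Exp semiring using (_^_; ^-congˡ)
  open import Algebra.Properties.CommutativeSemiring.Exp commutativeSemiring using (^-distrib-*)
  open import Algebra.Properties.CommutativeMonoid.Sum *-commutativeMonoid
    using (sum-permute; sum-cong-≋) renaming (sum to product)
  open import Data.Fin.Permutation using (Permutation; permutation)
  open import Relation.Binary.Reasoning.Setoid setoid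

  private
    zeroIndex : Fin (suc p)
    zeroIndex = proj₁ (surjective 0#)

  unit : Fin p → Carrier
  unit k = enum (punchIn zeroIndex k)

  unit-nonzero : ∀ k → unit k ≉ 0#
  unit-nonzero k unitₖ≈0 =
    Fin.punchInᵢ≢i zeroIndex k (injective _ _ (trans unitₖ≈0 (sym (proj₂ (surjective 0#)))))

  unit-injective : ∀ {k l} → unit k ≈ unit l → k ≡ l
  unit-injective unitₖ≈unitₗ = Fin.punchIn-injective zeroIndex _ _ (injective _ _ unitₖ≈unitₗ)

  unitIndex : ∀ {y} → y ≉ 0# → Fin p
  unitIndex {y} y≉0 = punchOut {i = zeroIndex} zeroIndex≢
    where
    zeroIndex≢ : zeroIndex ≢ proj₁ (surjective y)
    zeroIndex≢ eq = y≉0 (trans (sym (proj₂ (surjective y)))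
      (trans (reflexive (≡.cong enum (≡.sym eq))) (proj₂ (surjective 0#))))

  unit-unitIndex : ∀ {y} (y≉0 : y ≉ 0#) → unit (unitIndex y≉0) ≈ y
  unit-unitIndex {y} y≉0 = trans (reflexive (≡.cong enum (Fin.punchIn-punchOut _))) (proj₂ (surjective y))

  scaleUnits : ∀ {g} → g ≉ 0# → Fin p → Fin p
  scaleUnits g≉0 k = unitIndex (*-nonzero g≉0 (unit-nonzero k))

  unit-scaleUnits : ∀ {g} (g≉0 : g ≉ 0#) k → unit (scaleUnits g≉0 k) ≈ g * unit k
  unit-scaleUnits g≉0 k = unit-unitIndex (*-nonzero g≉0 (unit-nonzero k))

  scaleUnits-inverse : ∀ {g h} (g≉0 : g ≉ 0#) (h≉0 : h ≉ 0#) → g * h ≈ 1# →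
                       ∀ k → scaleUnits g≉0 (scaleUnits h≉0 k) ≡ k
  scaleUnits-inverse {g} {h} g≉0 h≉0 gh≈1 k = unit-injective (begin
    unit (scaleUnits g≉0 (scaleUnits h≉0 k)) ≈⟨ unit-scaleUnits g≉0 _ ⟩
    g * unit (scaleUnits h≉0 k)              ≈⟨ *-congˡ (unit-scaleUnits h≉0 k) ⟩
    g * (h * unit k)                         ≈⟨ *-assoc g h _ ⟨
    g * h * unit k                           ≈⟨ *-congʳ gh≈1 ⟩
    1# * unit k                              ≈⟨ *-identityˡ _ ⟩
    unit k                                   ∎)

  scalingPermutation : ∀ {g} → g ≉ 0# → Permutation p p
  scalingPermutation g≉0 = permutation (scaleUnits g≉0) (scaleUnits (inv-nonzero g≉0))
    (scaleUnits-inverse g≉0 (inv-nonzero g≉0) (*-inverseʳ g≉0))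
    (scaleUnits-inverse (inv-nonzero g≉0) g≉0 (*-inverseˡ g≉0))

  fermat : ∀ {x} → x ≉ 0# → x ^ p ≈ 1#
  fermat {x} x≉0 = *-cancelˡ (product-nonzero unit unit-nonzero) (begin
    product unit * x ^ p                        ≈⟨ *-comm _ _ ⟩
    x ^ p * product unit                        ≈⟨ product-scale x unit ⟨
    product (λ k → x * unit k)                  ≈⟨ sum-cong-≋ (λ k → sym (unit-scaleUnits x≉0 k)) ⟩
    product (unit ∘ scaleUnits x≉0)             ≈⟨ sum-permute unit (scalingPermutation x≉0) ⟨
    product unit                                ≈⟨ *-identityʳ _ ⟨
    product unit * 1#                           ∎)

  ^-injective : ∀ {d x y} → Coprime p d → x ≉ 0# → y ≉ 0# → x ^ d ≈ y ^ d → x ≈ y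
  ^-injective {d} {x} {y} p⊥d x≉0 y≉0 xᵈ≈yᵈ = begin
    x                 ≈⟨ *-identityʳ x ⟨
    x * 1#            ≈⟨ *-congˡ (*-inverseˡ y≉0) ⟨
    x * (inv y≉0 * y) ≈⟨ *-assoc x _ y ⟨
    x * inv y≉0 * y   ≈⟨ *-congʳ x/y≈1 ⟩
    1# * y            ≈⟨ *-identityˡ y ⟩
    y                 ∎
    where
    [x/y]ᵈ≈1 : (x * inv y≉0) ^ d ≈ 1#
    [x/y]ᵈ≈1 = begin
      (x * inv y≉0) ^ d   ≈⟨ ^-distrib-* x _ d ⟩
      x ^ d * inv y≉0 ^ d ≈⟨ *-congʳ xᵈ≈yᵈ ⟩
      y ^ d * inv y≉0 ^ d ≈⟨ ^-distrib-* y _ d ⟨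
      (y * inv y≉0) ^ d   ≈⟨ ^-congˡ d (*-inverseʳ y≉0) ⟩
      1# ^ d              ≈⟨ 1^n≈1 d ⟩
      1#                  ∎
    x/y≈1 : x * inv y≉0 ≈ 1#
    x/y≈1 = ^≈1-coprime p⊥d (fermat (*-nonzero x≉0 (inv-nonzero y≉0))) [x/y]ᵈ≈1

module MatrixProperties {c ℓ} (R : CommutativeRing c ℓ) where
  open CommutativeRing R hiding (zero)
  open MatrixOps R
  open import Algebra.Properties.Semiring.Sum semiring
    using (sum; sum-cong-≋; sum-remove; sum-replicate-zero; ∑-comm; *-distribˡ-sum; *-distribʳ-sum)
  open import Relation.Nullary using (yes; no)
  open import Data.Empty using (⊥-elim)
  open import Relation.Binary.Reasoning.Setoid setoid

  sumFin≡sum : ∀ {n} (f : Fin n → Carrier) → sumFin n f ≡ sum f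
  sumFin≡sum {zero}  f = ≡.refl
  sumFin≡sum {suc n} f = ≡.cong (f zero +_) (sumFin≡sum (f ∘ suc))

  sumFin≈sum : ∀ {n} (f : Fin n → Carrier) {g} → (∀ l → f l ≈ g l) → sumFin n f ≈ sum g
  sumFin≈sum f f≈g = trans (reflexive (sumFin≡sum f)) (sum-cong-≋ f≈g)

  sum-single : ∀ {n} (f : Fin n → Carrier) i → (∀ l → l ≢ i → f l ≈ 0#) → sum f ≈ f i
  sum-single {suc n} f i f≈0 = begin
    sum f                     ≈⟨ sum-remove f ⟩
    f i + sum (f ∘ punchIn i) ≈⟨ +-congˡ (sum-cong-≋ (λ k → f≈0 _ (Fin.punchInᵢ≢i i k))) ⟩
    f i + sum {n} (λ _ → 0#)  ≈⟨ +-congˡ (sum-replicate-zero n) ⟩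
    f i + 0#                  ≈⟨ +-identityʳ (f i) ⟩
    f i                       ∎

  identity-diag : ∀ {n} (i : Fin n) → identity n i i ≈ 1#
  identity-diag i with i Fin.≟ i
  ... | yes _  = refl
  ... | no i≢i = ⊥-elim (i≢i ≡.refl)

  identity-offdiag : ∀ {n} {i j : Fin n} → i ≢ j → identity n i j ≈ 0#
  identity-offdiag {i = i} {j} i≢j with i Fin.≟ j
  ... | yes i≡j = ⊥-elim (i≢j i≡j)
  ... | no _    = refl

  ≋identity : ∀ {k} {A : Matrix k k} → (∀ i → A i i ≈ 1#) → (∀ {i j} → i ≢ j → A i j ≈ 0#) → A ≋ identity k
  ≋identity Aᵢᵢ≈1 Aᵢⱼ≈0 i j with i Fin.≟ j
  ... | yes ≡.refl = Aᵢᵢ≈1 i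
  ... | no i≢j     = Aᵢⱼ≈0 i≢j

  ⊗-identityˡ : ∀ {k m} (A : Matrix k m) → (identity k ⊗ A) ≋ A
  ⊗-identityˡ {k} A i j = begin
    (identity k ⊗ A) i j                    ≈⟨ sumFin≈sum (λ l → identity k i l * A l j) (λ _ → refl) ⟩
    sum (λ l → identity k i l * A l j)      ≈⟨ sum-single _ i (λ l l≢i → trans (*-congʳ (identity-offdiag (l≢i ∘ ≡.sym))) (zeroˡ _)) ⟩
    identity k i i * A i j                  ≈⟨ trans (*-congʳ (identity-diag i)) (*-identityˡ _) ⟩
    A i j                                   ∎

  ⊗-identityʳ : ∀ {k m} (A : Matrix k m) → (A ⊗ identity m) ≋ A
  ⊗-identityʳ {m = m} A i j = begin
    (A ⊗ identity m) i j                    ≈⟨ sumFin≈sum (λ l → A i l * identity m l j) (λ _ → refl) ⟩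
    sum (λ l → A i l * identity m l j)      ≈⟨ sum-single _ j (λ l l≢j → trans (*-congˡ (identity-offdiag l≢j)) (zeroʳ _)) ⟩
    A i j * identity m j j                  ≈⟨ trans (*-congˡ (identity-diag j)) (*-identityʳ _) ⟩
    A i j                                   ∎

  ⊗-assoc : ∀ {k m n o} (A : Matrix k m) (B : Matrix m n) (C : Matrix n o) →
            ((A ⊗ B) ⊗ C) ≋ (A ⊗ (B ⊗ C))
  ⊗-assoc {k} {m} {n} A B C i j = begin
    sumFin n (λ l → (A ⊗ B) i l * C l j)
      ≈⟨ sumFin≈sum _ (λ l → trans (*-congʳ (sumFin≈sum (λ t → A i t * B t l) (λ _ → refl)))
                                     (*-distribʳ-sum (C l j) (λ t → A i t * B t l))) ⟩
    sum (λ l → sum (λ t → A i t * B t l * C l j))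
      ≈⟨ ∑-comm (λ l t → A i t * B t l * C l j) ⟩
    sum (λ t → sum (λ l → A i t * B t l * C l j))
      ≈⟨ sum-cong-≋ (λ t → trans (sum-cong-≋ (λ l → *-assoc (A i t) (B t l) (C l j)))
                                   (sym (*-distribˡ-sum (A i t) (λ l → B t l * C l j)))) ⟩
    sum (λ t → A i t * sum (λ l → B t l * C l j))
      ≈⟨ sumFin≈sum _ (λ t → *-congˡ (sumFin≈sum (λ l → B t l * C l j) (λ _ → refl))) ⟨
    sumFin m (λ t → A i t * (B ⊗ C) t j)
      ∎

  ⊗-congˡ : ∀ {k m n} {A A′ : Matrix k m} (B : Matrix m n) → A ≋ A′ → (A ⊗ B) ≋ (A′ ⊗ B)
  ⊗-congˡ {m = m} {A = A} {A′} B A≋A′ i j = begin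
    (A ⊗ B) i j                ≈⟨ sumFin≈sum (λ l → A i l * B l j) (λ l → *-congʳ (A≋A′ i l)) ⟩
    sum (λ l → A′ i l * B l j) ≈⟨ sumFin≈sum (λ l → A′ i l * B l j) (λ _ → refl) ⟨
    (A′ ⊗ B) i j               ∎

  rightInverse⇒invertible : ∀ {k} {M N : Matrix k k} →
                            (∀ {X Y : Matrix k k} → (M ⊗ X) ≋ (M ⊗ Y) → X ≋ Y) →
                            (M ⊗ N) ≋ identity k → Invertible k M
  rightInverse⇒invertible {k} {M} {N} M-cancel MN≈I = N , MN≈I , M-cancel M[NM]≈M[I]
    where
    M[NM]≈M[I] : (M ⊗ (N ⊗ M)) ≋ (M ⊗ identity k)
    M[NM]≈M[I] i j = begin
      (M ⊗ (N ⊗ M)) i j    ≈⟨ ⊗-assoc M N M i j ⟨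
      ((M ⊗ N) ⊗ M) i j    ≈⟨ ⊗-congˡ M MN≈I i j ⟩
      (identity k ⊗ M) i j ≈⟨ ⊗-identityˡ M i j ⟩
      M i j                ≈⟨ ⊗-identityʳ M i j ⟨
      (M ⊗ identity k) i j ∎

module Polynomials {c ℓ} (R : CommutativeRing c ℓ) where
  open CommutativeRing R hiding (zero)
  open import Algebra.Properties.CommutativeMonoid.Sum *-commutativeMonoid
    using () renaming (sum to product)
  open import Data.Vec.Functional using (Vector; []; _∷_; head; tail)
  open import Algebra.Solver.Ring.NaturalCoefficients.Default commutativeSemiring
    using (solve; _:=_; _:+_; _:*_; con)
  open MatrixOps R using (sumFin)
  open MatrixProperties R using (sumFin≈sum)
  open import Algebra.Properties.Semiring.Sum semiring using (sum; *-distribˡ-sum)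
  open import Algebra.Properties.Semiring.Exp semiring using (_^_)
  open import Relation.Binary.Reasoning.Setoid setoid

  -- Coefficient vectors list the constant coefficient first.
  eval : ∀ {n} → Vector Carrier n → Carrier → Carrier
  eval {zero}  v x = 0#
  eval {suc n} v x = head v + x * eval (tail v) x

  eval-cong : ∀ {n} {u v : Vector Carrier n} → (∀ l → u l ≈ v l) → ∀ x → eval u x ≈ eval v x
  eval-cong {zero}  u≈v x = refl
  eval-cong {suc n} u≈v x = +-cong (u≈v zero) (*-congˡ (eval-cong (u≈v ∘ suc) x))

  sum-powers≈eval : ∀ {n} (v : Vector Carrier n) x → sumFin n (λ l → x ^ toℕ l * v l) ≈ eval v x
  sum-powers≈eval {zero}  v x = refl
  sum-powers≈eval {suc n} v x = +-cong (*-identityˡ (v zero)) (begin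
    sumFin n (λ l → x * x ^ toℕ l * v (suc l))     ≈⟨ sumFin≈sum _ (λ l → *-assoc x (x ^ toℕ l) (v (suc l))) ⟩
    sum (λ l → x * (x ^ toℕ l * v (suc l)))         ≈⟨ *-distribˡ-sum x t ⟨
    x * sum t                                       ≈⟨ *-congˡ (sumFin≈sum t (λ _ → refl)) ⟨
    x * sumFin n (λ l → x ^ toℕ l * v (suc l))      ≈⟨ *-congˡ (sum-powers≈eval (tail v) x) ⟩
    x * eval (tail v) x                             ∎)
    where
    t = λ l → x ^ toℕ l * v (suc l)

  eval-+ : ∀ {n} (u v : Vector Carrier n) x → eval (λ l → u l + v l) x ≈ eval u x + eval v x
  eval-+ {zero}  u v x = sym (+-identityˡ 0#)
  eval-+ {suc n} u v x = begin
    (u zero + v zero) + x * eval (λ l → u (suc l) + v (suc l)) x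
      ≈⟨ +-congˡ (*-congˡ (eval-+ (tail u) (tail v) x)) ⟩
    (u zero + v zero) + x * (eval (tail u) x + eval (tail v) x)
      ≈⟨ solve 5 (λ a b x e f → (a :+ b) :+ x :* (e :+ f) := (a :+ x :* e) :+ (b :+ x :* f))
               refl (u zero) (v zero) x (eval (tail u) x) (eval (tail v) x) ⟩
    eval u x + eval v x ∎

  eval-scale : ∀ {n} e (v : Vector Carrier n) x → eval (λ l → e * v l) x ≈ e * eval v x
  eval-scale {zero}  e v x = sym (zeroʳ e)
  eval-scale {suc n} e v x = begin
    e * v zero + x * eval (λ l → e * v (suc l)) x ≈⟨ +-congˡ (*-congˡ (eval-scale e (tail v) x)) ⟩
    e * v zero + x * (e * eval (tail v) x)        ≈⟨ solve 4 (λ e a x t → e :* a :+ x :* (e :* t) := e :* (a :+ x :* t))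
                                                        refl e (v zero) x (eval (tail v) x) ⟩
    e * eval v x                                  ∎

  mulLinear : ∀ {n} → Carrier → Vector Carrier n → Vector Carrier (suc n)
  mulLinear {zero}  b v = 0# ∷ []
  mulLinear {suc n} b v = b * head v ∷ addHead (mulLinear b (tail v))
    where
    addHead : Vector Carrier (suc n) → Vector Carrier (suc n)
    addHead w = (head v + head w) ∷ tail w

  eval-mulLinear : ∀ {n} b (v : Vector Carrier n) x → eval (mulLinear b v) x ≈ (x + b) * eval v x
  eval-mulLinear {zero}  b v x = trans (+-identityˡ _) (trans (zeroʳ x) (sym (zeroʳ (x + b))))
  eval-mulLinear {suc n} b v x = begin
    b * v₀ + x * ((v₀ + head w) + x * eval (tail w) x) ≈⟨ +-congˡ (*-congˡ (+-assoc v₀ _ _)) ⟩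
    b * v₀ + x * (v₀ + eval w x)                       ≈⟨ +-congˡ (*-congˡ (+-congˡ (eval-mulLinear b (tail v) x))) ⟩
    b * v₀ + x * (v₀ + (x + b) * t)                    ≈⟨ solve 4 (λ b c x t → b :* c :+ x :* (c :+ (x :+ b) :* t)
                                                                 := (x :+ b) :* (c :+ x :* t)) refl b v₀ x t ⟩
    (x + b) * (v₀ + x * t)                             ∎
    where
    v₀ = head v
    w = mulLinear b (tail v)
    t = eval (tail v) x

  linearProduct : ∀ {k} → Vector Carrier k → Vector Carrier (suc k)
  linearProduct {zero}  b = 1# ∷ []
  linearProduct {suc k} b = mulLinear (head b) (linearProduct (tail b))

  eval-linearProduct : ∀ {k} (b : Vector Carrier k) x → eval (linearProduct b) x ≈ product (λ l → x + b l)
  eval-linearProduct {zero}  b x = trans (+-congˡ (zeroʳ x)) (+-identityʳ 1#)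
  eval-linearProduct {suc k} b x =
    trans (eval-mulLinear (head b) (linearProduct (tail b)) x) (*-congˡ (eval-linearProduct (tail b) x))

  quotient : ∀ {n} → Carrier → Vector Carrier (suc n) → Vector Carrier n
  quotient {zero}  r v = []
  quotient {suc n} r v = eval (tail v) r ∷ quotient r (tail v)

  -- v(x) = (x - r) q(x) + v(r), with the subtracted term moved across.
  eval-quotient : ∀ {n} r (v : Vector Carrier (suc n)) x →
                  eval v x + r * eval (quotient r v) x ≈ x * eval (quotient r v) x + eval v r
  eval-quotient {zero}  r v x = solve 3 (λ v₀ x r → v₀ :+ x :* con 0 :+ r :* con 0 := x :* con 0 :+ (v₀ :+ r :* con 0))
                                  refl (head v) x r
  eval-quotient {suc n} r v x = begin
    (v₀ + x * e) + r * (ρ + x * q)   ≈⟨ solve 6 (λ v₀ x e r ρ q → (v₀ :+ x :* e) :+ r :* (ρ :+ x :* q)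
                                                              := (v₀ :+ r :* ρ) :+ x :* (e :+ r :* q)) refl v₀ x e r ρ q ⟩
    (v₀ + r * ρ) + x * (e + r * q)   ≈⟨ +-congˡ (*-congˡ (eval-quotient r (tail v) x)) ⟩
    (v₀ + r * ρ) + x * (x * q + ρ)   ≈⟨ solve 5 (λ v₀ x r ρ q → (v₀ :+ r :* ρ) :+ x :* (x :* q :+ ρ)
                                                            := x :* (ρ :+ x :* q) :+ (v₀ :+ r :* ρ)) refl v₀ x r ρ q ⟩
    x * (ρ + x * q) + (v₀ + r * ρ)   ∎
    where
    v₀ = head v
    e = eval (tail v) x
    ρ = eval (tail v) r
    q = eval (quotient r (tail v)) x

  private
    head≈0 : ∀ {n} r (v : Vector Carrier (suc n)) → eval (tail v) r ≈ 0# → eval v r ≈ 0# → head v ≈ 0#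
    head≈0 r v tail[r]≈0 v[r]≈0 = begin
      head v                       ≈⟨ +-identityʳ _ ⟨
      head v + 0#                  ≈⟨ +-congˡ (trans (*-congˡ tail[r]≈0) (zeroʳ r)) ⟨
      head v + r * eval (tail v) r ≈⟨ v[r]≈0 ⟩
      0#                           ∎

  quotient≈0⇒≈0 : ∀ {n} r (v : Vector Carrier (suc n)) →
                  (∀ l → quotient r v l ≈ 0#) → eval v r ≈ 0# → ∀ l → v l ≈ 0#
  quotient≈0⇒≈0 {zero}  r v q≈0 v[r]≈0 zero    = head≈0 r v refl v[r]≈0
  quotient≈0⇒≈0 {suc n} r v q≈0 v[r]≈0 zero    = head≈0 r v (q≈0 zero) v[r]≈0
  quotient≈0⇒≈0 {suc n} r v q≈0 v[r]≈0 (suc l) = quotient≈0⇒≈0 r (tail v) (q≈0 ∘ suc) (q≈0 zero) l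

module PolynomialsOverField {c ℓ} (F : CommutativeRing c ℓ) (isField : IsField F) where
  open CommutativeRing F hiding (zero)
  open FieldProperties F isField
  open Polynomials F
  open import Algebra.Properties.Ring ring using (+-identityˡ-unique; x∙y⁻¹≈ε⇒x≈y; //-rightDividesˡ)
  open import Data.Vec.Functional using (Vector)
  open import Relation.Binary.Reasoning.Setoid setoid

  eval-vanishes⇒≈0 : ∀ {n} (v : Vector Carrier n) {r : Fin n → Carrier} → Injective _≡_ _≈_ r →
                     (∀ i → eval v (r i) ≈ 0#) → ∀ l → v l ≈ 0#
  eval-vanishes⇒≈0 {zero}  v r-inj v[r]≈0 ()
  eval-vanishes⇒≈0 {suc n} v {r} r-inj v[r]≈0 =
    quotient≈0⇒≈0 (r zero) v (eval-vanishes⇒≈0 q (Fin.suc-injective ∘ r-inj) q[r]≈0) (v[r]≈0 zero)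
    where
    q = quotient (r zero) v
    q[r]≈0 : ∀ i → eval q (r (suc i)) ≈ 0#
    q[r]≈0 i = x*z≈y*z⇒z≈0 (λ rᵢ≈r₀ → Fin.0≢1+n (≡.sym (r-inj rᵢ≈r₀))) (begin
      r (suc i) * eval q (r (suc i))                    ≈⟨ +-identityʳ _ ⟨
      r (suc i) * eval q (r (suc i)) + 0#               ≈⟨ +-congˡ (v[r]≈0 zero) ⟨
      r (suc i) * eval q (r (suc i)) + eval v (r zero)  ≈⟨ eval-quotient (r zero) v (r (suc i)) ⟨
      eval v (r (suc i)) + r zero * eval q (r (suc i))  ≈⟨ +-congʳ (v[r]≈0 (suc i)) ⟩
      0# + r zero * eval q (r (suc i))                  ≈⟨ +-identityˡ _ ⟩
      r zero * eval q (r (suc i))                       ∎)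

  eval-agrees⇒≈ : ∀ {n} (u v : Vector Carrier n) {r : Fin n → Carrier} → Injective _≡_ _≈_ r →
                  (∀ i → eval u (r i) ≈ eval v (r i)) → ∀ l → u l ≈ v l
  eval-agrees⇒≈ u v {r} r-inj u[r]≈v[r] l =
    x∙y⁻¹≈ε⇒x≈y (u l) (v l) (eval-vanishes⇒≈0 (λ l → u l - v l) r-inj [u-v][r]≈0 l)
    where
    [u-v][r]≈0 : ∀ i → eval (λ l → u l - v l) (r i) ≈ 0#
    [u-v][r]≈0 i = +-identityˡ-unique _ _ (begin
      eval (λ l → u l - v l) (r i) + eval v (r i) ≈⟨ eval-+ (λ l → u l - v l) v (r i) ⟨
      eval (λ l → u l - v l + v l) (r i)          ≈⟨ eval-cong (λ l → //-rightDividesˡ (v l) (u l)) (r i) ⟩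
      eval u (r i)                                ≈⟨ u[r]≈v[r] i ⟩
      eval v (r i)                                ∎)

module TwoByTwo {c ℓ} (F : CommutativeRing c ℓ) (isField : IsField F) where
  open CommutativeRing F hiding (zero)
  open FieldProperties F isField using (inv; *-inverseˡ)
  open MatrixOps F
  open import Algebra.Properties.Ring ring using (-1*x≈-x)
  open import Algebra.Solver.Ring.NaturalCoefficients.Default commutativeSemiring
    using (solve; _:=_; _:+_; _:*_; con)
  open import Relation.Binary.Reasoning.Setoid setoid

  det₂ : Matrix 2 2 → Carrier
  det₂ A = A zero zero * A (suc zero) (suc zero) - A zero (suc zero) * A (suc zero) zero

  det₂≉0⇒invertible : (A : Matrix 2 2) → det₂ A ≉ 0# → Invertible 2 A
  det₂≉0⇒invertible A δ≉0 = N , AN≈I , NA≈I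
    where
    a = A zero zero
    b = A zero (suc zero)
    c′ = A (suc zero) zero
    d = A (suc zero) (suc zero)
    e = inv δ≉0
    -- Writing -x as m * x keeps every entry identity inside commutative semirings.
    m = - 1#

    N : Matrix 2 2
    N zero    zero    = e * d
    N zero    (suc _) = e * (m * b)
    N (suc _) zero    = e * (m * c′)
    N (suc _) (suc _) = e * a

    diagonal : e * (a * d + m * (b * c′)) ≈ 1#
    diagonal = trans (*-congˡ (+-congˡ (-1*x≈-x (b * c′)))) (*-inverseˡ δ≉0)

    offDiagonal : ∀ x → x * (m + 1#) ≈ 0#
    offDiagonal x = trans (*-congˡ (-‿inverseˡ 1#)) (zeroʳ x)

    AN≈I : (A ⊗ N) ≋ identity 2
    AN≈I zero zero = trans (solve 6 (λ a b c d e m → a :* (e :* d) :+ (b :* (e :* (m :* c)) :+ con 0)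
                                                := e :* (a :* d :+ m :* (b :* c))) refl a b c′ d e m) diagonal
    AN≈I zero (suc zero) = trans (solve 6 (λ a b c d e m → a :* (e :* (m :* b)) :+ (b :* (e :* a) :+ con 0)
                                                := (e :* a :* b) :* (m :+ con 1)) refl a b c′ d e m) (offDiagonal _)
    AN≈I (suc zero) zero = trans (solve 6 (λ a b c d e m → c :* (e :* d) :+ (d :* (e :* (m :* c)) :+ con 0)
                                                := (e :* c :* d) :* (m :+ con 1)) refl a b c′ d e m) (offDiagonal _)
    AN≈I (suc zero) (suc zero) = trans (solve 6 (λ a b c d e m → c :* (e :* (m :* b)) :+ (d :* (e :* a) :+ con 0)
                                                := e :* (a :* d :+ m :* (b :* c))) refl a b c′ d e m) diagonal

    NA≈I : (N ⊗ A) ≋ identity 2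
    NA≈I zero zero = trans (solve 6 (λ a b c d e m → e :* d :* a :+ (e :* (m :* b) :* c :+ con 0)
                                                := e :* (a :* d :+ m :* (b :* c))) refl a b c′ d e m) diagonal
    NA≈I zero (suc zero) = trans (solve 6 (λ a b c d e m → e :* d :* b :+ (e :* (m :* b) :* d :+ con 0)
                                                := (e :* b :* d) :* (m :+ con 1)) refl a b c′ d e m) (offDiagonal _)
    NA≈I (suc zero) zero = trans (solve 6 (λ a b c d e m → e :* (m :* c) :* a :+ (e :* a :* c :+ con 0)
                                                := (e :* a :* c) :* (m :+ con 1)) refl a b c′ d e m) (offDiagonal _)
    NA≈I (suc zero) (suc zero) = trans (solve 6 (λ a b c d e m → e :* (m :* c) :* b :+ (e :* a :* d :+ con 0)
                                                := e :* (a :* d :+ m :* (b :* c))) refl a b c′ d e m) diagonal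

module Vandermonde {c ℓ} (F : CommutativeRing c ℓ) (isField : IsField F) where
  open CommutativeRing F hiding (zero)
  open FieldProperties F isField
  open MatrixOps F
  open MatrixProperties F using (≋identity; rightInverse⇒invertible)
  open Polynomials F
  open PolynomialsOverField F isField
  open import Algebra.Properties.Ring ring using (x∙y⁻¹≈ε⇒x≈y)
  open import Algebra.Properties.Semiring.Exp semiring using (_^_)
  open import Algebra.Properties.CommutativeMonoid.Sum *-commutativeMonoid
    using () renaming (sum to product)
  open import Relation.Nullary using (yes; no)

  vandermonde : ∀ {s} → (Fin s → Carrier) → Matrix s s
  vandermonde a i j = a i ^ toℕ j

  vandermonde-⊗ : ∀ {s} (a : Fin s → Carrier) (X : Matrix s s) i j →
                  (vandermonde a ⊗ X) i j ≈ eval (λ l → X l j) (a i)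
  vandermonde-⊗ a X i j = sum-powers≈eval (λ l → X l j) (a i)

  vandermonde-cancelˡ : ∀ {s} {a : Fin s → Carrier} → Injective _≡_ _≈_ a →
                        ∀ {X Y} → (vandermonde a ⊗ X) ≋ (vandermonde a ⊗ Y) → X ≋ Y
  vandermonde-cancelˡ {a = a} a-inj {X} {Y} VX≈VY l j = eval-agrees⇒≈ (λ l → X l j) (λ l → Y l j) a-inj
    (λ i → trans (sym (vandermonde-⊗ a X i j)) (trans (VX≈VY i j) (vandermonde-⊗ a Y i j))) l

  module Lagrange {k} {a : Fin (suc k) → Carrier} (a-inj : Injective _≡_ _≈_ a) where

    denominator-nonzero : ∀ j → product (λ l → a j - a (punchIn j l)) ≉ 0#
    denominator-nonzero j = product-nonzero _ (λ l aⱼ-aₗ≈0 →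
      Fin.punchInᵢ≢i j l (≡.sym (a-inj (x∙y⁻¹≈ε⇒x≈y _ _ aⱼ-aₗ≈0))))

    -- Column j holds the coefficients of the j-th Lagrange polynomial.
    basis : Matrix (suc k) (suc k)
    basis t j = inv (denominator-nonzero j) * linearProduct (λ l → - a (punchIn j l)) t

    eval-basis : ∀ j x → eval (λ t → basis t j) x ≈ inv (denominator-nonzero j) * product (λ l → x - a (punchIn j l))
    eval-basis j x = trans (eval-scale _ (linearProduct others) x) (*-congˡ (eval-linearProduct others x))
      where
      others = λ l → - a (punchIn j l)

    eval-basis-node : ∀ j → eval (λ t → basis t j) (a j) ≈ 1#
    eval-basis-node j = trans (eval-basis j (a j)) (*-inverseˡ _)

    eval-basis-otherNode : ∀ {i j} → i ≢ j → eval (λ t → basis t j) (a i) ≈ 0#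
    eval-basis-otherNode {i} {j} i≢j = trans (eval-basis j (a i))
      (trans (*-congˡ (product-zero _ (punchOut j≢i) aᵢ-aᵢ≈0)) (zeroʳ _))
      where
      j≢i = i≢j ∘ ≡.sym
      aᵢ-aᵢ≈0 : a i - a (punchIn j (punchOut j≢i)) ≈ 0#
      aᵢ-aᵢ≈0 = trans (+-congˡ (-‿cong (reflexive (≡.cong a (Fin.punchIn-punchOut j≢i))))) (-‿inverseʳ (a i))

  vandermonde-invertible : ∀ {s} {a : Fin s → Carrier} → Injective _≡_ _≈_ a → Invertible s (vandermonde a)
  vandermonde-invertible {zero}      _     = (λ ()) , (λ ()) , (λ ())
  vandermonde-invertible {suc k} {a} a-inj =
    rightInverse⇒invertible {M = vandermonde a} {N = basis} (vandermonde-cancelˡ a-inj) V⊗basis≈I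
    where
    open Lagrange a-inj
    basis-nodes : (λ i j → eval (λ t → basis t j) (a i)) ≋ identity (suc k)
    basis-nodes = ≋identity eval-basis-node eval-basis-otherNode
    V⊗basis≈I : (vandermonde a ⊗ basis) ≋ identity (suc k)
    V⊗basis≈I i j = trans (vandermonde-⊗ a basis i j) (basis-nodes i j)

module VandermondeMinors {c ℓ} (F : CommutativeRing c ℓ) (isField : IsField F)
                         {p} (hasOrder : HasOrder F (suc p)) where
  open CommutativeRing F hiding (zero)
  open FieldProperties F isField using (x^t*y^[t+d]≈x^[t+d]*y^t⇒y^d≈x^d)
  open FiniteField F isField hasOrder using (^-injective)
  open MatrixOps F
  open TwoByTwo F isField using (det₂)
  open Vandermonde F isField using (vandermonde)
  open import Algebra.Properties.Ring ring using (x∙y⁻¹≈ε⇒x≈y)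
  open import Algebra.Properties.Semiring.Exp semiring using (_^_; ^-congʳ)
  open import Relation.Binary.Reasoning.Setoid setoid

  vandermonde-minor-nonzero : Prime p → ∀ {s} {a : Fin s → Carrier} → Injective _≡_ _≈_ a →
                              (∀ i → a i ≉ 0#) → s ≤ p →
                              ∀ {i₁ i₂ j₁ j₂} → i₁ Fin.< i₂ → j₁ Fin.< j₂ →
                              det₂ (sub2 (vandermonde a) i₁ i₂ j₁ j₂) ≉ 0#
  vandermonde-minor-nonzero p-prime {a = a} a-inj a≉0 s≤p {i₁} {i₂} {j₁} {j₂} i₁<i₂ j₁<j₂ det≈0 =
    Fin.<⇒≢ i₁<i₂ (a-inj (^-injective p⊥d (a≉0 i₁) (a≉0 i₂) (sym aᵈ≈aᵈ)))
    where
    t = toℕ j₁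
    d = toℕ j₂ ∸ t
    t+d≡ : t ℕ.+ d ≡ toℕ j₂
    t+d≡ = ℕ.m+[n∸m]≡n (ℕ.<⇒≤ j₁<j₂)
    p⊥d : Coprime p d
    p⊥d = prime⇒coprime p-prime {{ℕ.>-nonZero (ℕ.m<n⇒0<n∸m j₁<j₂)}}
            (ℕ.<-≤-trans (ℕ.≤-<-trans (ℕ.m∸n≤m _ t) (Fin.toℕ<n j₂)) s≤p)
    cross : a i₁ ^ t * a i₂ ^ (t ℕ.+ d) ≈ a i₁ ^ (t ℕ.+ d) * a i₂ ^ t
    cross = begin
      a i₁ ^ t * a i₂ ^ (t ℕ.+ d) ≈⟨ *-congˡ (^-congʳ _ t+d≡) ⟩
      a i₁ ^ t * a i₂ ^ toℕ j₂    ≈⟨ x∙y⁻¹≈ε⇒x≈y _ _ det≈0 ⟩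
      a i₁ ^ toℕ j₂ * a i₂ ^ t    ≈⟨ *-congʳ (^-congʳ _ t+d≡) ⟨
      a i₁ ^ (t ℕ.+ d) * a i₂ ^ t ∎
    aᵈ≈aᵈ : a i₂ ^ d ≈ a i₁ ^ d
    aᵈ≈aᵈ = x^t*y^[t+d]≈x^[t+d]*y^t⇒y^d≈x^d t d (a≉0 i₁) (a≉0 i₂) cross

-- Imported only here: in the modules above, _^_ is exponentiation in the ring.
open import Data.Nat using (_^_)

theorem8 : ∀ {c ℓ : Level} (n : ℕ) → 1 ≤ n → Prime (2 ^ n ∸ 1) →
           (F : CommutativeRing c ℓ) → IsField F → HasOrder F (2 ^ n) →
           (s : ℕ) → 2 ≤ s → s ≤ 2 ^ n ∸ 1 →
           Σ (MatrixOps.Matrix F s s) λ M → MatrixOps.IsLinear2AONT F s M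
theorem8 n _ p-prime F isField hasOrder s _ s≤p =
  vandermonde a , vandermonde-invertible a-injective ,
  λ i₁ i₂ j₁ j₂ i₁<i₂ j₁<j₂ → det₂≉0⇒invertible (sub2 (vandermonde a) i₁ i₂ j₁ j₂)
    (vandermonde-minor-nonzero p-prime a-injective (λ i → unit-nonzero _) s≤p i₁<i₂ j₁<j₂)
  where
  open CommutativeRing F using (Carrier; _≈_)
  open MatrixOps F using (sub2)
  hasOrder′ : HasOrder F (suc (2 ^ n ∸ 1))
  hasOrder′ = ≡.subst (HasOrder F) (≡.sym (ℕ.m+[n∸m]≡n (ℕ.m^n>0 2 n))) hasOrder
  open FiniteField F isField hasOrder′ using (unit; unit-nonzero; unit-injective)
  open Vandermonde F isField using (vandermonde; vandermonde-invertible)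
  open VandermondeMinors F isField hasOrder′ using (vandermonde-minor-nonzero)
  open TwoByTwo F isField using (det₂≉0⇒invertible)
  a : Fin s → Carrier
  a i = unit (Fin.inject≤ i s≤p)
  a-injective : Injective _≡_ _≈_ a
  a-injective aᵢ≈aⱼ = Fin.inject≤-injective s≤p s≤p _ _ (unit-injective aᵢ≈aⱼ)
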